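{- Let $G$ be a finite simple graph with $m$ edges that is a disjoint union of stars and triangles. Then every matching $M$ of $G$ satisfies $d(M)=m$.
   Context: A star is a complete bipartite graph $K_{1,t}$ and a triangle is $K_3$. A matching of $G=(V,E)$ is a set of pairwise disjoint edges (the empty set included). The matching polytope $\mathcal{M}(G)$ is the convex hull of the incidence vectors $\chi_M\in\mathbb{R}^E$ of all matchings of $G$ (these are exactly its vertices); the skeleton $\mathcal{G}(\mathcal{M}(G))$ is the graph of vertices and edges (1-dimensional faces) of $\mathcal{M}(G)$, and $d(M)$ is the degree of $\chi_M$ in the skeleton. -}

module Defs where

open import Data.Nat using (ℕ; zero; suc)
open import Data.Integer using (ℤ; _+_; _≤_; 0ℤ; 1ℤ)
open import Data.Fin using (Fin)
open import Data.Fin.Subset using (Subset)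
open import Data.Bool using (Bool; true; false; if_then_else_)
open import Data.Vec using (lookup)
open import Data.List using (List; length)
open import Data.List.Membership.Propositional using (_∈_)
open import Data.List.Relation.Unary.Unique.Propositional using (Unique)
open import Data.Product using (Σ; ∃; _×_; _,_; proj₁; proj₂)
open import Data.Sum using (_⊎_)
open import Relation.Nullary using (¬_)
open import Relation.Binary.PropositionalEquality using (_≡_; _≢_)
open import Function.Bundles using (_⇔_)

SameEdge : {n : ℕ} → Fin n × Fin n → Fin n × Fin n → Set
SameEdge (a , b) (c , d) = (a ≡ c × b ≡ d) ⊎ (a ≡ d × b ≡ c)

record Graph : Set where
  field
    n m        : ℕ
    ends       : Fin m → Fin n × Fin n
    noLoop     : ∀ e → proj₁ (ends e) ≢ proj₂ (ends e)
    noParallel : ∀ e f → SameEdge (ends e) (ends f) → e ≡ f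

open Graph public

Adj : (G : Graph) → Fin (n G) → Fin (n G) → Set
Adj G u v = ∃ λ e → SameEdge (ends G e) (u , v)

Incident : (G : Graph) → Fin (n G) → Fin (m G) → Set
Incident G x e = (x ≡ proj₁ (ends G e)) ⊎ (x ≡ proj₂ (ends G e))

IsStarOn : (G : Graph) → (Fin (n G) → Set) → Set
IsStarOn G S = Σ (Fin (n G)) λ x → S x ×
  (∀ u v → S u → S v →
     Adj G u v ⇔ ((u ≡ x × v ≢ x) ⊎ (v ≡ x × u ≢ x)))

IsTriangleOn : (G : Graph) → (Fin (n G) → Set) → Set
IsTriangleOn G S = Σ (Fin (n G)) λ a → Σ (Fin (n G)) λ b → Σ (Fin (n G)) λ c →
  S a × S b × S c × a ≢ b × a ≢ c × b ≢ c ×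
  (∀ u → S u → (u ≡ a) ⊎ ((u ≡ b) ⊎ (u ≡ c))) ×
  Adj G a b × Adj G a c × Adj G b c

IsUnionOfStarsAndTriangles : Graph → Set
IsUnionOfStarsAndTriangles G = Σ ℕ λ k → Σ (Fin (n G) → Fin k) λ comp →
  (∀ u v → Adj G u v → comp u ≡ comp v) ×
  (∀ (c : Fin k) → IsStarOn G (λ v → comp v ≡ c) ⊎ IsTriangleOn G (λ v → comp v ≡ c))

IsMatching : (G : Graph) → Subset (m G) → Set
IsMatching G M = ∀ e f → lookup M e ≡ true → lookup M f ≡ true → e ≢ f →
  ∀ x → Incident G x e → ¬ Incident G x f

sumℤ : (k : ℕ) → (Fin k → ℤ) → ℤ
sumℤ zero    f = 0ℤ
sumℤ (suc k) f = f Fin.zero + sumℤ k (λ i → f (Fin.suc i))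

χ : {k : ℕ} → Subset k → Fin k → ℤ
χ M e = if lookup M e then 1ℤ else 0ℤ

weight : {k : ℕ} → (Fin k → ℤ) → Subset k → ℤ
weight {k} w M = sumℤ k (λ e → w e Data.Integer.* χ M e)

-- χ_M and χ_N span an edge (1-dimensional face) of the matching polytope:
-- M ≢ N and some linear functional w is maximised over the polytope
-- exactly on the face conv{χ_M, χ_N}, i.e. among all matchings exactly
-- M and N attain the maximum.  (Integer w.)
AdjacentInSkeleton : (G : Graph) → Subset (m G) → Subset (m G) → Set
AdjacentInSkeleton G M N = M ≢ N × Σ (Fin (m G) → ℤ) λ w →
  weight w M ≡ weight w N ×
  (∀ L → IsMatching G L → weight w L ≤ weight w M) ×
  (∀ L → IsMatching G L → weight w L ≡ weight w M → (L ≡ M) ⊎ (L ≡ N))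

DegreeIs : (G : Graph) → Subset (m G) → ℕ → Set
DegreeIs G M k = Σ (List (Subset (m G))) λ L → length L ≡ k × Unique L ×
  (∀ N → (N ∈ L) ⇔ (IsMatching G N × AdjacentInSkeleton G M N))

{-# OPTIONS --safe #-}
-- Two edges in the same star or triangle always share a vertex, so the matchings of G are
-- exactly the edge sets meeting every component in at most one edge: the partial
-- transversals of the partition of the edges by components. Their polytope is a product of
-- simplices, one per component, and M has one neighbour per edge e: change M only in the
-- component of e, to {e} if e ∉ M and to ∅ if e ∈ M. Each such neighbour is certified by the
-- sign weight of M (+1 on M, -1 off M) altered at e, and, if M has an edge g in the component
-- of e, with the terms of e and g bounded jointly. Conversely a neighbour N of M differs from
-- M in a single component, because swapping one component between M and N preserves the
-- total weight of the pair.
module Submission where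

open import Defs
open import Data.Bool using (Bool; true; false; not; _∧_; if_then_else_)
open import Data.Bool.Properties using (¬-not; not-¬; not-injective) renaming (_≟_ to _≟ᵇ_)
open import Data.Fin using (Fin; zero; suc)
open import Data.Fin.Properties using (_≟_; all?; any?; ¬∀⟶∃¬)
open import Data.Fin.Subset using (Subset)
open import Data.Integer using (ℤ; _+_; _-_; -_; _*_; _≤_; 0ℤ; 1ℤ; -1ℤ; +≤+; -≤+)
import Data.Integer.Properties as ℤ
open import Algebra.Properties.CommutativeSemigroup ℤ.+-commutativeSemigroup
  using (interchange; xy∙z≈xz∙y)
open import Data.List using (List; map; length; allFin)
open import Data.List.Properties using (length-map; length-tabulate)
open import Data.List.Membership.Propositional using (_∈_)
open import Data.List.Membership.Propositional.Properties using (∈-map⁺; ∈-map⁻; ∈-allFin)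
open import Data.List.Relation.Unary.Unique.Propositional using (Unique)
open import Data.List.Relation.Unary.Unique.Propositional.Properties using (map⁺; allFin⁺)
open import Data.Nat using (ℕ; zero; suc; z≤n)
open import Data.Product using (Σ; ∃; _×_; _,_; proj₁; proj₂)
open import Data.Sum as Sum using (_⊎_; inj₁; inj₂)
open import Data.Vec using (lookup; tabulate; _∷_; [])
open import Data.Vec.Properties using (lookup∘tabulate; tabulate∘lookup; tabulate-cong)
open import Data.Vec.Functional using (updateAt)
open import Data.Vec.Functional.Properties using (updateAt-updates; updateAt-minimal)
open import Function using (_∘_; const)
open import Function.Bundles using (_⇔_; mk⇔; Equivalence)
open import Relation.Binary.PropositionalEquality
  using (_≡_; _≢_; _≗_; refl; sym; trans; cong; cong₂; subst₂; module ≡-Reasoning)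
open import Relation.Nullary using (¬_; yes; no; does; contradiction)
open import Relation.Nullary.Decidable
  using (dec-true; dec-false; from-yes; ¬?; _×-dec_; _⊎-dec_; _→-dec_)
open import Relation.Unary using (_⊆_; _≐_)
open import Relation.Unary.Properties using (≐-sym)

open ≡-Reasoning

+-mono-≤-tight : ∀ {x X y Y : ℤ} → x ≤ X → y ≤ Y → x + y ≡ X + Y → x ≡ X × y ≡ Y
+-mono-≤-tight {x} {X} {y} {Y} x≤X y≤Y eq with x ℤ.≟ X | y ℤ.≟ Y
... | yes x≡X | yes y≡Y = x≡X , y≡Y
... | no x≢X  | _       = contradiction eq (ℤ.<⇒≢ (ℤ.+-mono-<-≤ (ℤ.≤∧≢⇒< x≤X x≢X) y≤Y))
... | _       | no y≢Y  = contradiction eq (ℤ.<⇒≢ (ℤ.+-mono-≤-< x≤X (ℤ.≤∧≢⇒< y≤Y y≢Y)))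

sumℤ-cong : ∀ k {a b : Fin k → ℤ} → a ≗ b → sumℤ k a ≡ sumℤ k b
sumℤ-cong zero    a≗b = refl
sumℤ-cong (suc k) a≗b = cong₂ _+_ (a≗b zero) (sumℤ-cong k (a≗b ∘ suc))

sumℤ-mono-≤ : ∀ k {a b : Fin k → ℤ} → (∀ i → a i ≤ b i) → sumℤ k a ≤ sumℤ k b
sumℤ-mono-≤ zero    a≤b = ℤ.≤-refl
sumℤ-mono-≤ (suc k) a≤b = ℤ.+-mono-≤ (a≤b zero) (sumℤ-mono-≤ k (a≤b ∘ suc))

sumℤ-mono-≤-tight : ∀ k {a b : Fin k → ℤ} → (∀ i → a i ≤ b i) → sumℤ k a ≡ sumℤ k b → a ≗ b
sumℤ-mono-≤-tight (suc k) a≤b eq i with +-mono-≤-tight (a≤b zero) (sumℤ-mono-≤ k (a≤b ∘ suc)) eq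
sumℤ-mono-≤-tight (suc k) a≤b eq zero    | head≡ , _     = head≡
sumℤ-mono-≤-tight (suc k) a≤b eq (suc i) | _     , tail≡ = sumℤ-mono-≤-tight k (a≤b ∘ suc) tail≡ i

sumℤ-distrib-+ : ∀ k (a b : Fin k → ℤ) → sumℤ k (λ i → a i + b i) ≡ sumℤ k a + sumℤ k b
sumℤ-distrib-+ zero    a b = refl
sumℤ-distrib-+ (suc k) a b =
  trans (cong (a zero + b zero +_) (sumℤ-distrib-+ k (a ∘ suc) (b ∘ suc)))
        (interchange (a zero) (b zero) (sumℤ k (a ∘ suc)) (sumℤ k (b ∘ suc)))

sumℤ-updateAt-+ : ∀ k (a : Fin k → ℤ) i x → sumℤ k (updateAt a i (_+ x)) ≡ sumℤ k a + x
sumℤ-updateAt-+ (suc k) a zero    x = xy∙z≈xz∙y (a zero) x _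
sumℤ-updateAt-+ (suc k) a (suc i) x =
  trans (cong (a zero +_) (sumℤ-updateAt-+ k (a ∘ suc) i x))
        (sym (ℤ.+-assoc (a zero) (sumℤ k (a ∘ suc)) x))

-- Transfers the entry at j onto i (leaving a j - a j at j), so that a termwise comparison
-- can bound the sum of two entries jointly.
merge : ∀ {k} → Fin k → Fin k → (Fin k → ℤ) → Fin k → ℤ
merge i j a = updateAt (updateAt a i (_+ a j)) j (_- a j)

sumℤ-merge : ∀ k i j (a : Fin k → ℤ) → sumℤ k (merge i j a) ≡ sumℤ k a
sumℤ-merge k i j a = begin
  sumℤ k (merge i j a)                   ≡⟨ sumℤ-updateAt-+ k _ j (- a j) ⟩
  sumℤ k (updateAt a i (_+ a j)) - a j   ≡⟨ cong (_- a j) (sumℤ-updateAt-+ k a i (a j)) ⟩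
  sumℤ k a + a j - a j                   ≡⟨ ℤ.+-assoc (sumℤ k a) (a j) (- a j) ⟩
  sumℤ k a + (a j - a j)                 ≡⟨ cong (sumℤ k a +_) (ℤ.+-inverseʳ (a j)) ⟩
  sumℤ k a + 0ℤ                          ≡⟨ ℤ.+-identityʳ _ ⟩
  sumℤ k a                               ∎

merge-target : ∀ {k} {i j : Fin k} a → j ≢ i → merge i j a i ≡ a i + a j
merge-target {i = i} {j} a j≢i =
  trans (updateAt-minimal i j _ (j≢i ∘ sym)) (updateAt-updates i a)

merge-source : ∀ {k} {i j : Fin k} a → j ≢ i → merge i j a j ≡ 0ℤ
merge-source {i = i} {j} a j≢i = begin
  merge i j a j                  ≡⟨ updateAt-updates j _ ⟩
  updateAt a i (_+ a j) j - a j  ≡⟨ cong (_- a j) (updateAt-minimal j i a j≢i) ⟩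
  a j - a j                      ≡⟨ ℤ.+-inverseʳ (a j) ⟩
  0ℤ                             ∎

merge-other : ∀ {k} {i j f : Fin k} a → f ≢ i → f ≢ j → merge i j a f ≡ a f
merge-other {i = i} {j} {f} a f≢i f≢j =
  trans (updateAt-minimal f j _ f≢j) (updateAt-minimal f i a f≢i)

subset-ext : ∀ {m} {A B : Subset m} → (∀ f → lookup A f ≡ lookup B f) → A ≡ B
subset-ext {A = A} {B} A≗B =
  trans (sym (tabulate∘lookup A)) (trans (tabulate-cong A≗B) (tabulate∘lookup B))

lookup-≡ : ∀ {m} {A B : Subset m} → A ≡ B → ∀ f → lookup A f ≡ lookup B f
lookup-≡ A≡B f = cong (λ L → lookup L f) A≡B

indicator : Bool → ℤ
indicator b = if b then 1ℤ else 0ℤ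

term : ∀ {m} → (Fin m → ℤ) → Subset m → Fin m → ℤ
term w L f = w f * χ L f

-- The skeleton of conv {χ L ∣ P L}: AdjacentInSkeleton G and DegreeIs G are the
-- instances P = IsMatching G.
Adjacent : ∀ {m} → (Subset m → Set) → Subset m → Subset m → Set
Adjacent {m} P M N = M ≢ N × Σ (Fin m → ℤ) λ w →
  weight w M ≡ weight w N ×
  (∀ L → P L → weight w L ≤ weight w M) ×
  (∀ L → P L → weight w L ≡ weight w M → (L ≡ M) ⊎ (L ≡ N))

HasDegree : ∀ {m} → (Subset m → Set) → Subset m → ℕ → Set
HasDegree {m} P M d = Σ (List (Subset m)) λ Ns → length Ns ≡ d × Unique Ns ×
  (∀ N → (N ∈ Ns) ⇔ (P N × Adjacent P M N))

Adjacent-antimono : ∀ {m} {P Q : Subset m → Set} {M N} → Q ⊆ P → Adjacent P M N → Adjacent Q M N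
Adjacent-antimono Q⊆P (M≢N , w , M≡N , maximal , maximisers) =
  M≢N , w , M≡N , (λ L → maximal L ∘ Q⊆P) , (λ L → maximisers L ∘ Q⊆P)

HasDegree-cong : ∀ {m} {P Q : Subset m → Set} {M d} → P ≐ Q → HasDegree P M d → HasDegree Q M d
HasDegree-cong (P⊆Q , Q⊆P) (Ns , length≡ , unique , spec) = Ns , length≡ , unique , λ N → mk⇔
  (λ N∈Ns → let (PN , adjacent) = Equivalence.to (spec N) N∈Ns
            in P⊆Q PN , Adjacent-antimono Q⊆P adjacent)
  (λ (QN , adjacent) → Equivalence.from (spec N) (Q⊆P QN , Adjacent-antimono P⊆Q adjacent))

adjacent-by-termwise-certificate : ∀ {m} {P : Subset m → Set} {M N : Subset m}
  (w : Fin m → ℤ) (T : Subset m → Fin m → ℤ) → (∀ L → weight w L ≡ sumℤ m (T L)) →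
  M ≢ N → (∀ L → P L → ∀ f → T L f ≤ T M f) → T N ≗ T M →
  (∀ L → P L → T L ≗ T M → L ≡ M ⊎ L ≡ N) → Adjacent P M N
adjacent-by-termwise-certificate {m} {M = M} {N} w T weight≡sum M≢N bound N-tight pinned =
  M≢N , w , M≡N , maximal , maximisers
  where
  M≡N : weight w M ≡ weight w N
  M≡N = begin
    weight w M     ≡⟨ weight≡sum M ⟩
    sumℤ m (T M)   ≡⟨ sumℤ-cong m N-tight ⟨
    sumℤ m (T N)   ≡⟨ weight≡sum N ⟨
    weight w N     ∎
  maximal : ∀ L → _ → weight w L ≤ weight w M
  maximal L PL = subst₂ _≤_ (sym (weight≡sum L)) (sym (weight≡sum M)) (sumℤ-mono-≤ m (bound L PL))
  maximisers : ∀ L → _ → weight w L ≡ weight w M → L ≡ M ⊎ L ≡ N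
  maximisers L PL L≡M = pinned L PL (sumℤ-mono-≤-tight m (bound L PL)
    (trans (sym (weight≡sum L)) (trans L≡M (weight≡sum M))))

-- M is the unique maximiser of the weight sign ∘ lookup M over all subsets.
sign : Bool → ℤ
sign b = if b then 1ℤ else -1ℤ

sign-bound : ∀ b c → sign b * indicator c ≤ sign b * indicator b
sign-bound true  true  = ℤ.≤-refl
sign-bound true  false = +≤+ z≤n
sign-bound false true  = -≤+
sign-bound false false = ℤ.≤-refl

sign-tight : ∀ b c → sign b * indicator c ≡ sign b * indicator b → c ≡ b
sign-tight true  true  _ = refl
sign-tight false false _ = refl

indicator-pair-bound : ∀ b c → ¬ (b ≡ true × c ≡ true) → indicator b + indicator c ≤ 1ℤ
indicator-pair-bound true  true  not-both = contradiction (refl , refl) not-both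
indicator-pair-bound true  false _ = ℤ.≤-refl
indicator-pair-bound false true  _ = ℤ.≤-refl
indicator-pair-bound false false _ = +≤+ z≤n

indicator-pair-tight : ∀ b c → indicator b + indicator c ≡ 1ℤ → b ≡ not c
indicator-pair-tight true  false _ = refl
indicator-pair-tight false true  _ = refl

module PartialTransversals {m k : ℕ} (class : Fin m → Fin k) where

  PartialTransversal : Subset m → Set
  PartialTransversal L =
    ∀ e f → lookup L e ≡ true → lookup L f ≡ true → e ≢ f → class e ≢ class f

  transversal-excludes : ∀ {L e f} → PartialTransversal L → lookup L e ≡ true →
    f ≢ e → class f ≡ class e → lookup L f ≡ false
  transversal-excludes L-PT Le f≢e same = ¬-not λ Lf → L-PT _ _ Lf Le f≢e same

  transversals-sharing-agree : ∀ {A B h f} → PartialTransversal A → PartialTransversal B →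
    lookup A h ≡ true → lookup B h ≡ true → class f ≡ class h → lookup A f ≡ lookup B f
  transversals-sharing-agree {A} {B} {h} {f} A-PT B-PT Ah Bh same with f ≟ h
  ... | yes refl = trans Ah (sym Bh)
  ... | no f≢h   = trans (transversal-excludes {A} A-PT Ah f≢h same)
                         (sym (transversal-excludes {B} B-PT Bh f≢h same))

  splice : Fin k → Subset m → Subset m → Subset m
  splice c A B = tabulate λ f → if does (class f ≟ c) then lookup A f else lookup B f

  lookup-splice-inside : ∀ {c} A B {f} → class f ≡ c → lookup (splice c A B) f ≡ lookup A f
  lookup-splice-inside {c} A B {f} inside = trans (lookup∘tabulate _ f)
    (cong (λ b → if b then lookup A f else lookup B f) (dec-true (class f ≟ c) inside))

  lookup-splice-outside : ∀ {c} A B {f} → class f ≢ c → lookup (splice c A B) f ≡ lookup B f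
  lookup-splice-outside {c} A B {f} outside = trans (lookup∘tabulate _ f)
    (cong (λ b → if b then lookup A f else lookup B f) (dec-false (class f ≟ c) outside))

  splice-transversal : ∀ c A B → PartialTransversal A → PartialTransversal B →
    PartialTransversal (splice c A B)
  splice-transversal c A B A-PT B-PT e f Se Sf e≢f same with class e ≟ c
  ... | yes inside = A-PT e f
    (trans (sym (lookup-splice-inside A B inside)) Se)
    (trans (sym (lookup-splice-inside A B (trans (sym same) inside))) Sf) e≢f same
  ... | no outside = B-PT e f
    (trans (sym (lookup-splice-outside A B outside)) Se)
    (trans (sym (lookup-splice-outside A B (outside ∘ trans same))) Sf) e≢f same

  weight-splice : ∀ w c A B →
    weight w (splice c A B) + weight w (splice c B A) ≡ weight w A + weight w B
  weight-splice w c A B = begin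
    weight w (splice c A B) + weight w (splice c B A)
      ≡⟨ sumℤ-distrib-+ m (term w (splice c A B)) (term w (splice c B A)) ⟨
    sumℤ m (λ f → term w (splice c A B) f + term w (splice c B A) f)
      ≡⟨ sumℤ-cong m exchange ⟩
    sumℤ m (λ f → term w A f + term w B f)
      ≡⟨ sumℤ-distrib-+ m (term w A) (term w B) ⟩
    weight w A + weight w B ∎
    where
    exchange : ∀ f → term w (splice c A B) f + term w (splice c B A) f ≡ term w A f + term w B f
    exchange f with class f ≟ c
    ... | yes inside rewrite lookup-splice-inside A B inside | lookup-splice-inside B A inside = refl
    ... | no outside rewrite lookup-splice-outside A B outside | lookup-splice-outside B A outside =
      ℤ.+-comm (term w B f) (term w A f)

  module _ (M : Subset m) (M-PT : PartialTransversal M) where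

    signs[_]≔_ : Fin m → ℤ → Fin m → ℤ
    signs[ e ]≔ b = updateAt (sign ∘ lookup M) e (const b)

    signs[]≔-at : ∀ e b → (signs[ e ]≔ b) e ≡ b
    signs[]≔-at e b = updateAt-updates e (sign ∘ lookup M)

    signs[]≔-off : ∀ {e b f} → f ≢ e → (signs[ e ]≔ b) f ≡ sign (lookup M f)
    signs[]≔-off {e} {f = f} f≢e = updateAt-minimal f e (sign ∘ lookup M) f≢e

    signed-term-bound : ∀ w {f} → w f ≡ sign (lookup M f) → ∀ L → term w L f ≤ term w M f
    signed-term-bound w {f} wf L =
      subst₂ _≤_ (cong (_* χ L f) (sym wf)) (cong (_* χ M f) (sym wf))
        (sign-bound (lookup M f) (lookup L f))

    signed-term-tight : ∀ w {f} → w f ≡ sign (lookup M f) → ∀ L → term w L f ≡ term w M f →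
      lookup L f ≡ lookup M f
    signed-term-tight w {f} wf L tight = sign-tight (lookup M f) (lookup L f)
      (trans (cong (_* χ L f) (sym wf)) (trans tight (cong (_* χ M f) wf)))

    replacement : Fin m → Fin m → Bool
    replacement e f = does (f ≟ e) ∧ not (lookup M e)

    neighbour : Fin m → Subset m
    neighbour e = splice (class e) (tabulate (replacement e)) M

    lookup-neighbour-self : ∀ e → lookup (neighbour e) e ≡ not (lookup M e)
    lookup-neighbour-self e = trans (lookup-splice-inside (tabulate (replacement e)) M refl)
      (trans (lookup∘tabulate (replacement e) e) (cong (_∧ not (lookup M e)) (dec-true (e ≟ e) refl)))

    lookup-neighbour-class : ∀ {e f} → f ≢ e → class f ≡ class e → lookup (neighbour e) f ≡ false
    lookup-neighbour-class {e} {f} f≢e same =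
      trans (lookup-splice-inside (tabulate (replacement e)) M same)
      (trans (lookup∘tabulate (replacement e) f) (cong (_∧ not (lookup M e)) (dec-false (f ≟ e) f≢e)))

    lookup-neighbour-outside : ∀ {e f} → class f ≢ class e → lookup (neighbour e) f ≡ lookup M f
    lookup-neighbour-outside {e} = lookup-splice-outside (tabulate (replacement e)) M

    lookup-neighbour-true : ∀ {e f} → lookup (neighbour e) f ≡ true →
      (f ≡ e × lookup M e ≡ false) ⊎ (class f ≢ class e × lookup M f ≡ true)
    lookup-neighbour-true {e} {f} Nf with f ≟ e | class f ≟ class e
    ... | yes refl | _          =
      inj₁ (refl , not-injective {y = false} (trans (sym (lookup-neighbour-self f)) Nf))
    ... | no f≢e   | yes same   = contradiction (trans (sym (lookup-neighbour-class f≢e same)) Nf) λ ()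
    ... | no _     | no outside = inj₂ (outside , trans (sym (lookup-neighbour-outside outside)) Nf)

    ≡-neighbour : ∀ {N} e → lookup N e ≡ not (lookup M e) →
      (∀ f → f ≢ e → class f ≡ class e → lookup N f ≡ false) →
      (∀ f → class f ≢ class e → lookup N f ≡ lookup M f) → N ≡ neighbour e
    ≡-neighbour {N} e self inside outside = subset-ext pointwise
      where
      pointwise : ∀ f → lookup N f ≡ lookup (neighbour e) f
      pointwise f with f ≟ e | class f ≟ class e
      ... | yes refl | _        = trans self (sym (lookup-neighbour-self e))
      ... | no f≢e   | yes same = trans (inside f f≢e same) (sym (lookup-neighbour-class f≢e same))
      ... | no _     | no out   = trans (outside f out) (sym (lookup-neighbour-outside out))

    neighbour-transversal : ∀ e → PartialTransversal (neighbour e)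
    neighbour-transversal e f₁ f₂ N₁ N₂ f₁≢f₂ same
      with lookup-neighbour-true N₁ | lookup-neighbour-true N₂
    ... | inj₁ (refl , _)  | inj₁ (refl , _)  = f₁≢f₂ refl
    ... | inj₁ (refl , _)  | inj₂ (out₂ , _)  = out₂ (sym same)
    ... | inj₂ (out₁ , _)  | inj₁ (refl , _)  = out₁ same
    ... | inj₂ (_ , M₁)    | inj₂ (_ , M₂)    = M-PT f₁ f₂ M₁ M₂ f₁≢f₂ same

    M≢neighbour : ∀ e → M ≢ neighbour e
    M≢neighbour e M≡N = not-¬ refl (trans (lookup-≡ M≡N e) (lookup-neighbour-self e))

    neighbour-injective : ∀ {e e′} → neighbour e ≡ neighbour e′ → e ≡ e′
    neighbour-injective {e} {e′} N≡N′ with e ≟ e′ | class e ≟ class e′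
    ... | yes e≡e′ | _ = e≡e′
    ... | no e≢e′ | no out =
      contradiction (trans (sym (lookup-neighbour-self e))
                           (trans (lookup-≡ N≡N′ e) (lookup-neighbour-outside out)))
                    (not-¬ refl ∘ sym)
    ... | no e≢e′ | yes same =
      contradiction same (M-PT e e′ (∈M e≢e′ same N≡N′) (∈M (e≢e′ ∘ sym) (sym same) (sym N≡N′)) e≢e′)
      where
      ∈M : ∀ {e e′} → e ≢ e′ → class e ≡ class e′ → neighbour e ≡ neighbour e′ → lookup M e ≡ true
      ∈M {e} {e′} e≢e′ same N≡N′ = not-injective {y = true}
        (trans (sym (lookup-neighbour-self e))
               (trans (lookup-≡ N≡N′ e) (lookup-neighbour-class e≢e′ same)))

    neighbour-adjacent-toggle : ∀ e → (∀ f → f ≢ e → class f ≡ class e → lookup M f ≡ false) →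
      Adjacent PartialTransversal M (neighbour e)
    neighbour-adjacent-toggle e alone =
      adjacent-by-termwise-certificate w (term w) (λ _ → refl) (M≢neighbour e) bound N-tight pinned
      where
      w : Fin m → ℤ
      w = signs[ e ]≔ 0ℤ
      term-at-e : ∀ L → term w L e ≡ 0ℤ
      term-at-e L = cong (_* χ L e) (signs[]≔-at e 0ℤ)
      N-agrees : ∀ {f} → f ≢ e → lookup (neighbour e) f ≡ lookup M f
      N-agrees {f} f≢e with class f ≟ class e
      ... | yes same   = trans (lookup-neighbour-class f≢e same) (sym (alone f f≢e same))
      ... | no outside = lookup-neighbour-outside outside
      bound : ∀ L → PartialTransversal L → ∀ f → term w L f ≤ term w M f
      bound L _ f with f ≟ e
      ... | yes refl = ℤ.≤-reflexive (trans (term-at-e L) (sym (term-at-e M)))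
      ... | no f≢e   = signed-term-bound w (signs[]≔-off f≢e) L
      N-tight : term w (neighbour e) ≗ term w M
      N-tight f with f ≟ e
      ... | yes refl = trans (term-at-e (neighbour e)) (sym (term-at-e M))
      ... | no f≢e   = cong (λ b → w f * indicator b) (N-agrees f≢e)
      off : ∀ L → term w L ≗ term w M → ∀ {f} → f ≢ e → lookup L f ≡ lookup M f
      off L tight {f} f≢e = signed-term-tight w (signs[]≔-off f≢e) L (tight f)
      agree : ∀ L → lookup L e ≡ lookup M e → term w L ≗ term w M → ∀ f → lookup L f ≡ lookup M f
      agree L Le≡Me tight f with f ≟ e
      ... | yes refl = Le≡Me
      ... | no f≢e   = off L tight f≢e
      pinned : ∀ L → PartialTransversal L → term w L ≗ term w M → L ≡ M ⊎ L ≡ neighbour e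
      pinned L _ tight with lookup L e ≟ᵇ lookup M e
      ... | yes Le≡Me = inj₁ (subset-ext (agree L Le≡Me tight))
      ... | no Le≢Me  = inj₂ (≡-neighbour e (¬-not Le≢Me)
        (λ f f≢e same → trans (off L tight f≢e) (alone f f≢e same))
        (λ f out → off L tight (out ∘ cong class)))

    -- The weight is +1 on both e and g; only the transversal property bounds their pair,
    -- so their two terms are merged into one.
    module Exchange {e g : Fin m} (Me : lookup M e ≡ false) (Mg : lookup M g ≡ true)
                    (same : class g ≡ class e) where

      w : Fin m → ℤ
      w = signs[ e ]≔ 1ℤ

      T : Subset m → Fin m → ℤ
      T L = merge e g (term w L)

      g≢e : g ≢ e
      g≢e refl = contradiction (trans (sym Me) Mg) λ ()

      T-pair : ∀ L → T L e ≡ indicator (lookup L e) + indicator (lookup L g)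
      T-pair L = trans (merge-target (term w L) g≢e) (cong₂ _+_
        (trans (cong (_* χ L e) (signs[]≔-at e 1ℤ)) (ℤ.*-identityˡ (χ L e)))
        (trans (cong (_* χ L g) (trans (signs[]≔-off g≢e) (cong sign Mg))) (ℤ.*-identityˡ (χ L g))))

      T-M-pair : T M e ≡ 1ℤ
      T-M-pair = trans (T-pair M) (cong₂ (λ b c → indicator b + indicator c) Me Mg)

      T-at-g : ∀ L → T L g ≡ 0ℤ
      T-at-g L = merge-source (term w L) g≢e

      T-off : ∀ L {f} → f ≢ e → f ≢ g → T L f ≡ term w L f
      T-off L f≢e f≢g = merge-other (term w L) f≢e f≢g

      bound : ∀ L → PartialTransversal L → ∀ f → T L f ≤ T M f
      bound L L-PT f with f ≟ e | f ≟ g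
      ... | yes refl | _        = subst₂ _≤_ (sym (T-pair L)) (sym T-M-pair)
        (indicator-pair-bound _ _ λ (Le , Lg) → L-PT e g Le Lg (g≢e ∘ sym) (sym same))
      ... | no _     | yes refl = ℤ.≤-reflexive (trans (T-at-g L) (sym (T-at-g M)))
      ... | no f≢e   | no f≢g   = subst₂ _≤_ (sym (T-off L f≢e f≢g)) (sym (T-off M f≢e f≢g))
        (signed-term-bound w (signs[]≔-off f≢e) L)

      N-agrees : ∀ {f} → f ≢ e → f ≢ g → lookup (neighbour e) f ≡ lookup M f
      N-agrees {f} f≢e f≢g with class f ≟ class e
      ... | yes same-f = trans (lookup-neighbour-class f≢e same-f)
        (sym (transversal-excludes {M} M-PT Mg f≢g (trans same-f (sym same))))
      ... | no outside = lookup-neighbour-outside outside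

      N-tight : T (neighbour e) ≗ T M
      N-tight f with f ≟ e | f ≟ g
      ... | yes refl | _        = trans (T-pair (neighbour e))
        (trans (cong₂ (λ b c → indicator b + indicator c)
                      (trans (lookup-neighbour-self e) (cong not Me)) (lookup-neighbour-class g≢e same))
               (sym T-M-pair))
      ... | no _     | yes refl = trans (T-at-g (neighbour e)) (sym (T-at-g M))
      ... | no f≢e   | no f≢g   = trans (T-off (neighbour e) f≢e f≢g)
        (trans (cong (λ b → w f * indicator b) (N-agrees f≢e f≢g)) (sym (T-off M f≢e f≢g)))

      off : ∀ L → T L ≗ T M → ∀ {f} → f ≢ e → f ≢ g → lookup L f ≡ lookup M f
      off L tight f≢e f≢g = signed-term-tight w (signs[]≔-off f≢e) L
        (trans (sym (T-off L f≢e f≢g)) (trans (tight _) (T-off M f≢e f≢g)))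

      Le≡¬Lg : ∀ L → T L ≗ T M → lookup L e ≡ not (lookup L g)
      Le≡¬Lg L tight = indicator-pair-tight _ _ (trans (sym (T-pair L)) (trans (tight e) T-M-pair))

      pinned : ∀ L → PartialTransversal L → T L ≗ T M → L ≡ M ⊎ L ≡ neighbour e
      pinned L _ tight with lookup L g ≟ᵇ true
      ... | yes Lg = inj₁ (subset-ext agree)
        where
        agree : ∀ f → lookup L f ≡ lookup M f
        agree f with f ≟ e | f ≟ g
        ... | yes refl | _        = trans (Le≡¬Lg L tight) (trans (cong not Lg) (sym Me))
        ... | no _     | yes refl = trans Lg (sym Mg)
        ... | no f≢e   | no f≢g   = off L tight f≢e f≢g
      ... | no Lg≢true = inj₂ (≡-neighbour e
        (trans (Le≡¬Lg L tight) (trans (cong not Lg) (sym (cong not Me)))) inside outside)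
        where
        Lg : lookup L g ≡ false
        Lg = ¬-not Lg≢true
        inside : ∀ f → f ≢ e → class f ≡ class e → lookup L f ≡ false
        inside f f≢e same-f with f ≟ g
        ... | yes refl = Lg
        ... | no f≢g   = trans (off L tight f≢e f≢g)
          (transversal-excludes {M} M-PT Mg f≢g (trans same-f (sym same)))
        outside : ∀ f → class f ≢ class e → lookup L f ≡ lookup M f
        outside f out = off L tight (out ∘ cong class) (λ { refl → out same })

      adjacent : Adjacent PartialTransversal M (neighbour e)
      adjacent = adjacent-by-termwise-certificate w T (λ L → sym (sumℤ-merge m e g (term w L)))
        (M≢neighbour e) bound N-tight pinned

    neighbour-adjacent : ∀ e → Adjacent PartialTransversal M (neighbour e)
    neighbour-adjacent e with lookup M e ≟ᵇ true
    ... | yes Me =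
      neighbour-adjacent-toggle e (λ f f≢e same → transversal-excludes {M} M-PT Me f≢e same)
    ... | no Me≢true with any? (λ g → (lookup M g ≟ᵇ true) ×-dec (class g ≟ class e))
    ...   | yes (g , Mg , same) = Exchange.adjacent (¬-not Me≢true) Mg same
    ...   | no none = neighbour-adjacent-toggle e (λ f _ same → ¬-not λ Mf → none (f , Mf , same))

    differing-in-one-class⇒neighbour : ∀ {N e} → PartialTransversal N → lookup M e ≢ lookup N e →
      (∀ f → class f ≢ class e → lookup N f ≡ lookup M f) → ∃ λ e′ → N ≡ neighbour e′
    differing-in-one-class⇒neighbour {N} {e} N-PT Me≢Ne outside
      with any? (λ h → (lookup N h ≟ᵇ true) ×-dec (class h ≟ class e))
    ... | yes (h , Nh , same) = h , ≡-neighbour h (trans Nh (sym (cong not Mh)))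
      (λ f f≢h same-f → transversal-excludes {N} N-PT Nh f≢h same-f)
      (λ f out → outside f (λ same-f → out (trans same-f (sym same))))
      where
      Mh : lookup M h ≡ false
      Mh = ¬-not λ Mh → Me≢Ne (transversals-sharing-agree {M} {N} M-PT N-PT Mh Nh (sym same))
    ... | no none = e , ≡-neighbour e (trans Ne (sym (cong not Me)))
      (λ f _ same-f → ¬-not λ Nf → none (f , Nf , same-f)) outside
      where
      Ne : lookup N e ≡ false
      Ne = ¬-not λ Ne → none (e , Ne , refl)
      Me : lookup M e ≡ true
      Me = ¬-not λ Me → Me≢Ne (trans Me (sym Ne))

    -- Exchanging the class of e between M and N gives two transversals of total weight
    -- weight M + weight N, so both are optimal; the one carrying N on that class is not M,
    -- hence it is N, i.e. N agrees with M off the class of e.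
    adjacent⇒neighbour : ∀ {N} → PartialTransversal N → Adjacent PartialTransversal M N →
      ∃ λ e → N ≡ neighbour e
    adjacent⇒neighbour {N} N-PT (M≢N , w , M≡N , maximal , maximisers) =
      differing-in-one-class⇒neighbour N-PT Me≢Ne N-outside
      where
      differing : ∃ λ e → lookup M e ≢ lookup N e
      differing = ¬∀⟶∃¬ m _ (λ f → lookup M f ≟ᵇ lookup N f) (M≢N ∘ subset-ext)
      e : Fin m
      e = proj₁ differing
      Me≢Ne : lookup M e ≢ lookup N e
      Me≢Ne = proj₂ differing
      L₁ L₂ : Subset m
      L₁ = splice (class e) N M
      L₂ = splice (class e) M N
      L₁-PT : PartialTransversal L₁
      L₁-PT = splice-transversal (class e) N M N-PT M-PT
      L₁-optimal : weight w L₁ ≡ weight w M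
      L₁-optimal = proj₁ (+-mono-≤-tight
        (maximal L₁ L₁-PT) (maximal L₂ (splice-transversal (class e) M N M-PT N-PT)) (begin
          weight w L₁ + weight w L₂  ≡⟨ weight-splice w (class e) N M ⟩
          weight w N + weight w M    ≡⟨ ℤ.+-comm (weight w N) (weight w M) ⟩
          weight w M + weight w N    ≡⟨ cong (weight w M +_) M≡N ⟨
          weight w M + weight w M    ∎))
      L₁≡N : L₁ ≡ N
      L₁≡N with maximisers L₁ L₁-PT L₁-optimal
      ... | inj₁ L₁≡M =
        contradiction (trans (sym (lookup-≡ L₁≡M e)) (lookup-splice-inside N M refl)) Me≢Ne
      ... | inj₂ L₁≡N = L₁≡N
      N-outside : ∀ f → class f ≢ class e → lookup N f ≡ lookup M f
      N-outside f out = trans (sym (lookup-≡ L₁≡N f)) (lookup-splice-outside N M out)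

    transversal-degree : HasDegree PartialTransversal M m
    transversal-degree = map neighbour (allFin m) ,
      trans (length-map neighbour (allFin m)) (length-tabulate (λ i → i)) ,
      map⁺ neighbour-injective (allFin⁺ m) , λ N → mk⇔ listed⇒adjacent adjacent⇒listed
      where
      listed⇒adjacent : ∀ {N} → N ∈ map neighbour (allFin m) →
        PartialTransversal N × Adjacent PartialTransversal M N
      listed⇒adjacent N∈ with ∈-map⁻ neighbour N∈
      ... | e , _ , refl = neighbour-transversal e , neighbour-adjacent e
      adjacent⇒listed : ∀ {N} → PartialTransversal N × Adjacent PartialTransversal M N →
        N ∈ map neighbour (allFin m)
      adjacent⇒listed (N-PT , adjacent) with adjacent⇒neighbour N-PT adjacent
      ... | e , refl = ∈-map⁺ neighbour (∈-allFin e)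

distinct-pairs-in-Fin3-meet : ∀ (i j k l : Fin 3) → i ≢ j → k ≢ l →
  ∃ λ x → (x ≡ i ⊎ x ≡ j) × (x ≡ k ⊎ x ≡ l)
distinct-pairs-in-Fin3-meet = from-yes
  (all? λ (i : Fin 3) → all? λ (j : Fin 3) → all? λ (k : Fin 3) → all? λ (l : Fin 3) →
    ¬? (i ≟ j) →-dec (¬? (k ≟ l) →-dec
    any? λ (x : Fin 3) → ((x ≟ i) ⊎-dec (x ≟ j)) ×-dec ((x ≟ k) ⊎-dec (x ≟ l))))

module Triple {A : Set} (a b c : A) where

  Member : A → Set
  Member u = u ≡ a ⊎ u ≡ b ⊎ u ≡ c

  vertex : Fin 3 → A
  vertex = lookup (a ∷ b ∷ c ∷ [])

  index : ∀ {u} → Member u → Fin 3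
  index (inj₁ _)        = zero
  index (inj₂ (inj₁ _)) = suc zero
  index (inj₂ (inj₂ _)) = suc (suc zero)

  vertex-index : ∀ {u} (p : Member u) → u ≡ vertex (index p)
  vertex-index (inj₁ u≡a)        = u≡a
  vertex-index (inj₂ (inj₁ u≡b)) = u≡b
  vertex-index (inj₂ (inj₂ u≡c)) = u≡c

  index-injective : ∀ {u v} (p : Member u) (q : Member v) → index p ≡ index q → u ≡ v
  index-injective p q same = trans (vertex-index p) (trans (cong vertex same) (sym (vertex-index q)))

  distinct-pairs-meet : ∀ {u₁ u₂ v₁ v₂} → Member u₁ → Member u₂ → Member v₁ → Member v₂ →
    u₁ ≢ u₂ → v₁ ≢ v₂ → ∃ λ x → (x ≡ u₁ ⊎ x ≡ u₂) × (x ≡ v₁ ⊎ x ≡ v₂)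
  distinct-pairs-meet p₁ p₂ q₁ q₂ u₁≢u₂ v₁≢v₂ =
    let (x , x∈p , x∈q) = distinct-pairs-in-Fin3-meet (index p₁) (index p₂) (index q₁) (index q₂)
                            (u₁≢u₂ ∘ index-injective p₁ p₂) (v₁≢v₂ ∘ index-injective q₁ q₂)
    in vertex x , Sum.map (at p₁) (at p₂) x∈p , Sum.map (at q₁) (at q₂) x∈q
    where
    at : ∀ {u} (p : Member u) {x} → x ≡ index p → vertex x ≡ u
    at p x≡i = trans (cong vertex x≡i) (sym (vertex-index p))

module StarsAndTriangles (G : Graph) {k : ℕ} (comp : Fin (n G) → Fin k)
  (comp-closed : ∀ u v → Adj G u v → comp u ≡ comp v)
  (shape : ∀ c → IsStarOn G (λ v → comp v ≡ c) ⊎ IsTriangleOn G (λ v → comp v ≡ c)) where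

  edgeClass : Fin (m G) → Fin k
  edgeClass e = comp (proj₁ (ends G e))

  comp-second-end : ∀ e → comp (proj₂ (ends G e)) ≡ edgeClass e
  comp-second-end e = sym (comp-closed _ _ (e , inj₁ (refl , refl)))

  comp-incident : ∀ {x e} → Incident G x e → comp x ≡ edgeClass e
  comp-incident         (inj₁ refl) = refl
  comp-incident {e = e} (inj₂ refl) = comp-second-end e

  edges-in-class-meet : ∀ e f → edgeClass e ≡ edgeClass f → ∃ λ x → Incident G x e × Incident G x f
  edges-in-class-meet e f same with shape (edgeClass e)
  ... | inj₁ (x , _ , star) = x , centre-incident e refl , centre-incident f (sym same)
    where
    centre-incident : ∀ e′ → edgeClass e′ ≡ edgeClass e → Incident G x e′
    centre-incident e′ inside
      with Equivalence.to (star _ _ inside (trans (comp-second-end e′) inside))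
                          (e′ , inj₁ (refl , refl))
    ... | inj₁ (first≡x , _)  = inj₁ (sym first≡x)
    ... | inj₂ (second≡x , _) = inj₂ (sym second≡x)
  ... | inj₂ (a , b , c , _ , _ , _ , _ , _ , _ , members , _) =
    Triple.distinct-pairs-meet a b c
      (members _ refl) (members _ (comp-second-end e))
      (members _ (sym same)) (members _ (trans (comp-second-end f) (sym same)))
      (noLoop G e) (noLoop G f)

  open PartialTransversals edgeClass

  matching≐transversal : IsMatching G ≐ PartialTransversal
  matching≐transversal = (λ {L} → matching⇒transversal {L}) , (λ {L} → transversal⇒matching {L})
    where
    matching⇒transversal : IsMatching G ⊆ PartialTransversal
    matching⇒transversal {L} matching e f Le Lf e≢f same =
      let (x , x∈e , x∈f) = edges-in-class-meet e f same in matching e f Le Lf e≢f x x∈e x∈f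
    transversal⇒matching : PartialTransversal ⊆ IsMatching G
    transversal⇒matching {L} transversal e f Le Lf e≢f x x∈e x∈f =
      transversal e f Le Lf e≢f (trans (sym (comp-incident x∈e)) (comp-incident x∈f))

lemma3p3 : (G : Graph) → IsUnionOfStarsAndTriangles G →
    (M : Subset (m G)) → IsMatching G M → DegreeIs G M (m G)
lemma3p3 G (k , comp , comp-closed , shape) M M-matching =
  HasDegree-cong (≐-sym matching≐transversal)
    (transversal-degree M (proj₁ matching≐transversal {M} M-matching))
  where
  open StarsAndTriangles G comp comp-closed shape
  open PartialTransversals edgeClass
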